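{- There exist block graphs $G$ of diameter $3$ for which the bandwidth $B(G)$ is strictly greater than the local density $\beta(G)$.
   Context: All graphs are finite and simple. A block graph is a graph in which every block (maximal 2-connected subgraph or bridge) is a clique. For an injection $f\colon V(G)\to\mathbb{Z}$, its bandwidth is $B(f)=\max_{uv\in E(G)}|f(u)-f(v)|$; the bandwidth of $G$ is $B(G)=\min_f B(f)$ over all such injections. Writing $n(H)=|V(H)|$, the local density of $G$ is $\beta(G)=\max_{H}\lceil (n(H)-1)/\operatorname{diam} H\rceil$, the maximum over connected subgraphs $H\subseteq G$ with at least two vertices. -}

module Defs where

open import Data.Nat using (ℕ; zero; suc; _+_; _∸_; _≤_; _<_)
open import Data.Nat.DivMod using (_/_)
open import Data.Integer as ℤ using (ℤ)
open import Data.Bool using (Bool; true; false; _∧_)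
open import Data.Fin using (Fin)
open import Data.Fin.Subset using (Subset; _∈_; _⊆_; _-_; ∣_∣; Nonempty; ⊤)
open import Data.Vec using (lookup)
open import Data.Product using (Σ; ∃; ∃-syntax; _×_; _,_)
open import Function.Definitions using (Injective)
open import Relation.Binary.PropositionalEquality using (_≡_; _≢_)
open import Relation.Nullary using (¬_)

record Graph : Set where
  field
    n     : ℕ
    adj   : Fin n → Fin n → Bool
    sym   : ∀ u v → adj u v ≡ true → adj v u ≡ true
    irrefl : ∀ u → adj u u ≡ false
open Graph public

data Walk {m : ℕ} (A : Fin m → Fin m → Bool) : Fin m → Fin m → ℕ → Set where
  here : ∀ {u} → Walk A u u 0
  step : ∀ {u v w k} → A u v ≡ true → Walk A v w k → Walk A u w (suc k)

Dist≤ : ∀ {m} → (Fin m → Fin m → Bool) → Fin m → Fin m → ℕ → Set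
Dist≤ A u v k = ∃[ j ] (j ≤ k × Walk A u v j)

DiamBound : ∀ {m} → Subset m → (Fin m → Fin m → Bool) → ℕ → Set
DiamBound V A d = ∀ u v → u ∈ V → v ∈ V → Dist≤ A u v d

HasDiam : ∀ {m} → Subset m → (Fin m → Fin m → Bool) → ℕ → Set
HasDiam V A d = DiamBound V A d × (∀ d′ → DiamBound V A d′ → d ≤ d′)

record Subgraph (G : Graph) : Set where
  field
    V : Subset (n G)
    E : Fin (n G) → Fin (n G) → Bool
    E⊆ : ∀ u v → E u v ≡ true → (adj G u v ≡ true) × (u ∈ V) × (v ∈ V)
    Esym : ∀ u v → E u v ≡ true → E v u ≡ true
open Subgraph public

-- ceiling of a / d (d ≥ 1; value for d = 0 is irrelevant, set to 0)
ceilDiv : ℕ → ℕ → ℕ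
ceilDiv a zero = 0
ceilDiv a (suc d) = (a + d) / suc d

IsLocalDensity : Graph → ℕ → Set
IsLocalDensity G β =
  (∀ (H : Subgraph G) (d : ℕ) → 2 ≤ ∣ V H ∣ → HasDiam (V H) (E H) d →
     ceilDiv (∣ V H ∣ ∸ 1) d ≤ β)
  × (Σ (Subgraph G) λ H → ∃[ d ] (2 ≤ ∣ V H ∣ × HasDiam (V H) (E H) d ×
       ceilDiv (∣ V H ∣ ∸ 1) d ≡ β))

BandwidthAtMost : (G : Graph) → (Fin (n G) → ℤ) → ℕ → Set
BandwidthAtMost G f k = ∀ u v → adj G u v ≡ true → ℤ.∣ f u ℤ.- f v ∣ ≤ k

IsBandwidth : Graph → ℕ → Set
IsBandwidth G b =
  (∃[ f ] (Injective _≡_ _≡_ f × BandwidthAtMost G f b))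
  × (∀ (f : Fin (n G) → ℤ) → Injective _≡_ _≡_ f → ∀ k → BandwidthAtMost G f k → b ≤ k)

inducedAdj : (G : Graph) → Subset (n G) → Fin (n G) → Fin (n G) → Bool
inducedAdj G S u v = adj G u v ∧ lookup S u ∧ lookup S v

InducedConnected : (G : Graph) → Subset (n G) → Set
InducedConnected G S = ∀ u v → u ∈ S → v ∈ S → ∃[ k ] Walk (inducedAdj G S) u v k

-- G[S] is a nonempty connected graph without a cut vertex
-- (i.e. 2-connected, a bridge K₂, or a single vertex)
NonsepSet : (G : Graph) → Subset (n G) → Set
NonsepSet G S = Nonempty S × InducedConnected G S
  × (∀ v → v ∈ S → InducedConnected G (S - v))

IsBlock : (G : Graph) → Subset (n G) → Set
IsBlock G S = NonsepSet G S × (∀ S′ → S ⊆ S′ → NonsepSet G S′ → S′ ⊆ S)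

IsClique : (G : Graph) → Subset (n G) → Set
IsClique G S = ∀ u v → u ∈ S → v ∈ S → u ≢ v → adj G u v ≡ true

IsBlockGraph : Graph → Set
IsBlockGraph G = ∀ S → IsBlock G S → IsClique G S

GraphDiam : Graph → ℕ → Set
GraphDiam G d = HasDiam ⊤ (adj G) d

{-# OPTIONS --safe #-}
module Submission where

-- G is K₄ with a triangle glued at three of its vertices, a block graph of diameter 3 on
-- 10 vertices. Its local density is 3: a subgraph of diameter 1 is a clique (at most 4
-- vertices), one of diameter 2 cannot contain pendant vertices of two different triangles
-- (at most 6 vertices), and one of diameter d ≥ 3 has at most 10 ≤ 3d + 1 vertices.
-- A layout of bandwidth 3 would put the 10 vertices on consecutive integers with the two
-- extreme ones at distance 3, i.e. pendant vertices of two triangles joined by a geodesic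
-- whose edges all have length exactly 3; this pins down everything except the third
-- triangle, which then has no room. So B(G) = 4, attained by an explicit layout.

open import Defs
open import Data.Nat using (_<_)
open import Data.Product using (Σ; ∃-syntax; _×_)

open import Data.Bool using (Bool; true; false; T; not; _∧_; _∨_; if_then_else_)
import Data.Bool.Properties as Bool
open import Data.Bool.ListAction using (all; any)
open import Data.Fin using (Fin; zero; suc; #_; _≟_)
open import Data.Fin.Properties using (all?; any?)
open import Data.Fin.Subset using (Subset; inside; outside; ⊤; _∈_; _∉_; _-_; ∣_∣)
open import Data.Fin.Subset.Properties using (_∈?_; anySubset?; ∈⊤; ∣p∣≤n; x∈p∧x≢y⇒x∈p-y)
open import Data.Integer as ℤ using (ℤ; +_; -[1+_]; 0ℤ)
import Data.Integer.Properties as ℤ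
open import Data.Integer.Tactic.RingSolver using (solve-∀)
open import Data.List using (List; []; _∷_; [_]; _++_; map; upTo)
open import Data.List.Membership.Propositional using (lose) renaming (_∈_ to _∈ˡ_)
open import Data.List.Membership.Propositional.Properties using (∈-map⁺; ∈-++⁺ˡ; ∈-++⁺ʳ; ∈-upTo⁺)
open import Data.List.Relation.Unary.All as All using (All; []; _∷_)
open import Data.List.Relation.Unary.Any.Properties using (any⁺)
open import Data.Maybe using (Maybe; just; nothing; maybe)
open import Data.Nat as ℕ using (ℕ; zero; suc; _+_; _*_; _∸_; _≤_; z≤n; s≤s; _≤?_; _<?_)
import Data.Nat.Properties as ℕ
open import Data.Nat.DivMod using (m<n*o⇒m/o<n)
open import Data.Product using (_,_; proj₁; proj₂)
open import Data.Vec using (_∷_; []; lookup; there)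
open import Data.Vec.Properties using (lookup⇒[]=)
open import Function using (_∘_; _⇔_; mk⇔; Equivalence)
open import Function.Definitions using (Injective)
open import Relation.Binary.PropositionalEquality as ≡ using (_≡_; _≢_; refl; trans; subst; cong)
open import Relation.Nullary using (¬_; yes; no; contradiction)
open import Relation.Nullary.Decidable
  using (Dec; ⌊_⌋; from-yes; fromWitness; toWitnessFalse; False; _×-dec_; _→-dec_; ¬?)

module _ {m : ℕ} (A : Fin m → Fin m → Bool) where

  record IsDistance (d : Fin m → Fin m → ℕ) : Set where
    field
      diag    : ∀ v → d v v ≡ 0
      edge    : ∀ u w v → A u w ≡ true → d u v ≤ suc (d w v)
      descent : ∀ u v → u ≢ v → ∃[ w ] (A u w ≡ true × suc (d w v) ≡ d u v)

  module _ {d : Fin m → Fin m → ℕ} (isDistance : IsDistance d) where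
    open IsDistance isDistance

    dist≤walkLength : ∀ {u v k} → Walk A u v k → d u v ≤ k
    dist≤walkLength {v = v} here = ℕ.≤-reflexive (diag v)
    dist≤walkLength {u} {v} (step {v = w} uw walk) =
      ℕ.≤-trans (edge u w v uw) (s≤s (dist≤walkLength walk))

    walkOfLength : ∀ k u v → d u v ≡ k → Walk A u v k
    walkOfLength k u v duv≡k with u ≟ v
    ... | yes refl = subst (Walk A u u) (trans (≡.sym (diag u)) duv≡k) here
    ... | no u≢v with descent u v u≢v
    ...   | w , uw , dwv+1≡duv with k
    ...     | zero  = contradiction (trans dwv+1≡duv duv≡k) λ ()
    ...     | suc k = step uw (walkOfLength k w v (ℕ.suc-injective (trans dwv+1≡duv duv≡k)))

    Dist≤⇔dist≤ : ∀ {u v k} → Dist≤ A u v k ⇔ d u v ≤ k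
    Dist≤⇔dist≤ {u} {v} = mk⇔
      (λ (j , j≤k , walk) → ℕ.≤-trans (dist≤walkLength walk) j≤k)
      (λ duv≤k → d u v , duv≤k , walkOfLength (d u v) u v refl)

    hasDiam : ∀ {k} → (∀ u v → d u v ≤ k) → ∃[ u ] ∃[ v ] d u v ≡ k → HasDiam ⊤ A k
    hasDiam bound (u , v , duv≡k) =
        (λ x y _ _ → Equivalence.from Dist≤⇔dist≤ (bound x y))
      , λ k′ diamBound → subst (_≤ k′) duv≡k (Equivalence.to Dist≤⇔dist≤ (diamBound u v ∈⊤ ∈⊤))

x∉p-x : ∀ {m} (p : Subset m) (x : Fin m) → x ∉ p - x
x∉p-x (inside  ∷ p) zero    ()
x∉p-x (outside ∷ p) zero    ()
x∉p-x (_       ∷ p) (suc x) (there x∈p-x) = x∉p-x p x x∈p-x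

module _ (G : Graph) where

  private
    Vertex : Set
    Vertex = Fin (n G)

  inducedAdj⇒adj : ∀ {S u v} → inducedAdj G S u v ≡ true → adj G u v ≡ true × u ∈ S × v ∈ S
  inducedAdj⇒adj {S} {u} {v} e with adj G u v | lookup S u in u∈S | lookup S v in v∈S | e
  ... | true | true | true | refl = refl , lookup⇒[]= u S u∈S , lookup⇒[]= v S v∈S

  ConstantAcrossEdgesAvoiding : Vertex → (Vertex → Bool) → Set
  ConstantAcrossEdgesAvoiding c s = ∀ x y → adj G x y ≡ true → x ≢ c → y ≢ c → s x ≡ s y

  Separates : Vertex → (Vertex → Bool) → Vertex → Vertex → Set
  Separates c s u v = u ≢ c × v ≢ c × s u ≢ s v × ConstantAcrossEdgesAvoiding c s

  colour-invariant : ∀ {S : Subset (n G)} {c s u v k} →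
                     c ∉ S → ConstantAcrossEdgesAvoiding c s →
                     Walk (inducedAdj G S) u v k → s u ≡ s v
  colour-invariant c∉S s-edge here = refl
  colour-invariant {S} c∉S s-edge (step {u = x} {v = y} xy walk) =
    let adj-xy , x∈S , y∈S = inducedAdj⇒adj {S} xy
    in  trans (s-edge x y adj-xy (λ { refl → c∉S x∈S }) (λ { refl → c∉S y∈S }))
              (colour-invariant c∉S s-edge walk)

  separated⇒¬nonsep : ∀ {c s u v} {S : Subset (n G)} →
                      Separates c s u v → u ∈ S → v ∈ S → ¬ NonsepSet G S
  separated⇒¬nonsep {c} {u = u} {v} {S} (u≢c , v≢c , su≢sv , s-edge) u∈S v∈S (_ , connected , 2-connected)
    with c ∈? S
  ... | no  c∉S = su≢sv (colour-invariant c∉S s-edge (proj₂ (connected u v u∈S v∈S)))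
  ... | yes c∈S = su≢sv (colour-invariant (x∉p-x S c) s-edge
                    (proj₂ (2-connected c c∈S u v (x∈p∧x≢y⇒x∈p-y u∈S u≢c) (x∈p∧x≢y⇒x∈p-y v∈S v≢c))))

  separated⇒isBlockGraph : (∀ u v → u ≢ v → adj G u v ≡ false → ∃[ c ] ∃[ s ] Separates c s u v) →
                           IsBlockGraph G
  separated⇒isBlockGraph separator S (nonsep , _) u v u∈S v∈S u≢v with adj G u v in uv
  ... | true  = refl
  ... | false = let c , s , separates = separator u v u≢v uv
                in  contradiction nonsep (separated⇒¬nonsep separates u∈S v∈S)

ceilDiv-≤ : ∀ a d q → a ≤ q * suc d → ceilDiv a (suc d) ≤ q
ceilDiv-≤ a d q a≤qd = ℕ.≤-pred (m<n*o⇒m/o<n {n = suc q}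
  (s≤s (ℕ.≤-trans (ℕ.+-monoˡ-≤ d a≤qd) (ℕ.≤-reflexive (ℕ.+-comm (q * suc d) d)))))

walk-lift : ∀ {G} (H : Subgraph G) {u v k} → Walk (E H) u v k → Walk (adj G) u v k
walk-lift H here = here
walk-lift H (step {u} {v} uv walk) = step (proj₁ (E⊆ H u v uv)) (walk-lift H walk)

wholeGraph : (G : Graph) → Subgraph G
wholeGraph G = record { V = ⊤ ; E = adj G ; E⊆ = λ u v uv → uv , ∈⊤ , ∈⊤ ; Esym = sym G }

isBandwidth-suc : ∀ {G b} →
                  (∃[ f ] (Injective _≡_ _≡_ f × BandwidthAtMost G f (suc b))) →
                  (∀ f → Injective _≡_ _≡_ f → ¬ BandwidthAtMost G f b) →
                  IsBandwidth G (suc b)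
isBandwidth-suc {G} {b} layout noLayout = layout , bandwidth≥
  where
  bandwidth≥ : ∀ f → Injective _≡_ _≡_ f → ∀ k → BandwidthAtMost G f k → suc b ≤ k
  bandwidth≥ f f-inj k f≤k with k ≤? b
  ... | yes k≤b = contradiction (λ u v uv → ℕ.≤-trans (f≤k u v uv) k≤b) (noLayout f f-inj)
  ... | no  k≰b = ℕ.≰⇒> k≰b

shift-injective : ∀ {m} {f : Fin m → ℤ} c → Injective _≡_ _≡_ f → Injective _≡_ _≡_ (λ v → f v ℤ.- c)
shift-injective {f = f} c f-inj {u} {v} e = f-inj (begin
  f u               ≡⟨ [i-k]+k≡i (f u) c ⟨
  f u ℤ.- c ℤ.+ c   ≡⟨ cong (ℤ._+ c) e ⟩
  f v ℤ.- c ℤ.+ c   ≡⟨ [i-k]+k≡i (f v) c ⟩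
  f v               ∎)
  where
  open ≡.≡-Reasoning
  [i-k]+k≡i : ∀ i k → i ℤ.- k ℤ.+ k ≡ i
  [i-k]+k≡i = solve-∀

shift-bandwidth : ∀ {G f k} c → BandwidthAtMost G f k → BandwidthAtMost G (λ v → f v ℤ.- c) k
shift-bandwidth {f = f} {k} c f-bw u v uv =
  subst (λ i → ℤ.∣ i ∣ ≤ k) (≡.sym ([i-k]-[j-k]≡i-j (f u) (f v) c)) (f-bw u v uv)
  where
  [i-k]-[j-k]≡i-j : ∀ i j k → (i ℤ.- k) ℤ.- (j ℤ.- k) ≡ i ℤ.- j
  [i-k]-[j-k]≡i-j = solve-∀

j+[i-j]≡i : ∀ i j → j ℤ.+ (i ℤ.- j) ≡ i
j+[i-j]≡i = solve-∀

-- A layout of bandwidth ≤ k is searched for vertex by vertex along a spanning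
-- tree: after translating the root to 0, each vertex lies within k of its parent.
module LayoutSearch (G : Graph) (k : ℕ) where

  private
    Vertex : Set
    Vertex = Fin (n G)

  Placement : Set
  Placement = Vertex × ℤ

  Compatible : Placement → Placement → Set
  Compatible (u , i) (v , j) =
    (u ≡ v → i ≡ j) × (i ≡ j → u ≡ v) × (adj G u v ≡ true → ℤ.∣ i ℤ.- j ∣ ≤ k)

  compatible? : ∀ p q → Dec (Compatible p q)
  compatible? (u , i) (v , j) =
    (u ≟ v →-dec i ℤ.≟ j) ×-dec (i ℤ.≟ j →-dec u ≟ v) ×-dec
    (adj G u v Bool.≟ true →-dec ℤ.∣ i ℤ.- j ∣ ≤? k)

  labelOf : List Placement → Vertex → Maybe ℤ
  labelOf []            v = nothing
  labelOf ((u , i) ∷ σ) v = if ⌊ u ≟ v ⌋ then just i else labelOf σ v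

  offsets : List ℤ
  offsets = map -[1+_] (upTo k) ++ map +_ (upTo (suc k))

  offset-∈ : ∀ {t} → ℤ.∣ t ∣ ≤ k → t ∈ˡ offsets
  offset-∈ {+ t}      t≤k = ∈-++⁺ʳ (map -[1+_] (upTo k)) (∈-map⁺ +_ (∈-upTo⁺ (s≤s t≤k)))
  offset-∈ { -[1+ t ]} t<k = ∈-++⁺ˡ (∈-map⁺ -[1+_] (∈-upTo⁺ t<k))

  mutual
    extendable : List (Vertex × Vertex) → List Placement → Bool
    extendable []                 σ = true
    extendable ((v , p) ∷ order) σ =
      maybe (λ j → any (λ t → placeable order σ (v , j ℤ.+ t)) offsets) true (labelOf σ p)

    placeable : List (Vertex × Vertex) → List Placement → Placement → Bool
    placeable order σ q = all (λ q′ → ⌊ compatible? q′ q ⌋) σ ∧ extendable order (q ∷ σ)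

  SpanningOrder : List (Vertex × Vertex) → Set
  SpanningOrder = All (λ (v , parent) → adj G parent v ≡ true)

  module _ {f : Vertex → ℤ} (f-inj : Injective _≡_ _≡_ f) (f-bw : BandwidthAtMost G f k) where

    Agrees : List Placement → Set
    Agrees = All (λ (v , i) → f v ≡ i)

    labelOf-agrees : ∀ {σ v j} → Agrees σ → labelOf σ v ≡ just j → f v ≡ j
    labelOf-agrees {(u , i) ∷ σ} {v} (fu≡i ∷ σ≈f) σv≡j with u ≟ v
    labelOf-agrees (fu≡i ∷ σ≈f) refl | yes refl = fu≡i
    labelOf-agrees (fu≡i ∷ σ≈f) σv≡j | no  _    = labelOf-agrees σ≈f σv≡j

    all-compatible : ∀ {σ} v → Agrees σ → T (all (λ q → ⌊ compatible? q (v , f v) ⌋) σ)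
    all-compatible v [] = _
    all-compatible v (_∷_ {x = u , _} refl σ≈f) =
      Equivalence.from Bool.T-∧ (fromWitness (cong f , f-inj , λ uv → f-bw u v uv) , all-compatible v σ≈f)

    extendable-complete : ∀ order σ → SpanningOrder order → Agrees σ → T (extendable order σ)
    extendable-complete []                 σ _                σ≈f = _
    extendable-complete ((v , p) ∷ order) σ (pv ∷ spanning) σ≈f with labelOf σ p in σp
    ... | nothing = _
    ... | just j  = any⁺ _ (lose (offset-∈ within-k) (subst (λ i → T (placeable order σ (v , i)))
                                                       (≡.sym (j+[i-j]≡i (f v) j)) placed))
      where
      within-k : ℤ.∣ f v ℤ.- j ∣ ≤ k
      within-k = subst (λ i → ℤ.∣ f v ℤ.- i ∣ ≤ k) (labelOf-agrees σ≈f σp) (f-bw v p (sym G p v pv))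
      placed : T (placeable order σ (v , f v))
      placed = Equivalence.from Bool.T-∧
        (all-compatible v σ≈f , extendable-complete order ((v , f v) ∷ σ) spanning (refl ∷ σ≈f))

  noLayout : ∀ root order → SpanningOrder order → extendable order [ root , 0ℤ ] ≡ false →
             ∀ f → Injective _≡_ _≡_ f → ¬ BandwidthAtMost G f k
  noLayout root order spanning exhausted f f-inj f-bw =
    subst T exhausted (extendable-complete (shift-injective c f-inj) (shift-bandwidth {G} {f} c f-bw)
      order _ spanning (ℤ.+-inverseʳ c ∷ []))
    where
    c : ℤ
    c = f root

-- G is K₄ on 0, 1, 2, 3 with the triangles {1,4,5}, {2,6,7}, {3,8,9} glued on;
-- hub v is the vertex of K₄ that v belongs to or hangs off.
hub : Fin 10 → Fin 10
hub = lookup (# 0 ∷ # 1 ∷ # 2 ∷ # 3 ∷ # 1 ∷ # 1 ∷ # 2 ∷ # 2 ∷ # 3 ∷ # 3 ∷ [])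

isCore : Fin 10 → Bool
isCore v = ⌊ hub v ≟ v ⌋

adjacent : Fin 10 → Fin 10 → Bool
adjacent u v = not ⌊ u ≟ v ⌋ ∧ ((isCore u ∧ isCore v) ∨ ⌊ hub u ≟ hub v ⌋)

G : Graph
G = record
  { n      = 10
  ; adj    = adjacent
  ; sym    = from-yes (all? λ u → all? λ v → adjacent u v Bool.≟ true →-dec adjacent v u Bool.≟ true)
  ; irrefl = from-yes (all? λ u → adjacent u u Bool.≟ false)
  }

dist : Fin 10 → Fin 10 → ℕ
dist u v = if ⌊ u ≟ v ⌋ then 0 else if ⌊ hub u ≟ hub v ⌋ then 1 else suc (depth u + depth v)
  where
  depth : Fin 10 → ℕ
  depth v = if isCore v then 0 else 1

dist-isDistance : IsDistance adjacent dist
dist-isDistance = record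
  { diag    = from-yes (all? λ v → dist v v ℕ.≟ 0)
  ; edge    = from-yes (all? λ u → all? λ w → all? λ v → adjacent u w Bool.≟ true →-dec dist u v ≤? suc (dist w v))
  ; descent = from-yes (all? λ u → all? λ v → ¬? (u ≟ v) →-dec
                any? λ w → (adjacent u w Bool.≟ true) ×-dec (suc (dist w v) ℕ.≟ dist u v))
  }

G-diameter : GraphDiam G 3
G-diameter = hasDiam adjacent dist-isDistance
  (from-yes (all? λ u → all? λ v → dist u v ≤? 3)) (# 4 , # 6 , refl)

cutVertex : Fin 10 → Fin 10 → Fin 10
cutVertex u v = hub (if isCore u then v else u)

hangsOff : Fin 10 → Fin 10 → Bool
hangsOff c x = not (isCore x) ∧ ⌊ hub x ≟ c ⌋

G-isBlockGraph : IsBlockGraph G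
G-isBlockGraph = separated⇒isBlockGraph G λ u v u≢v uv →
  cutVertex u v , hangsOff (cutVertex u v) , separates u v u≢v uv
  where
  separates : ∀ u v → u ≢ v → adjacent u v ≡ false →
              Separates G (cutVertex u v) (hangsOff (cutVertex u v)) u v
  separates = from-yes (all? λ u → all? λ v → ¬? (u ≟ v) →-dec adjacent u v Bool.≟ false →-dec
    let c = cutVertex u v ; s = hangsOff c in
    ¬? (u ≟ c) ×-dec ¬? (v ≟ c) ×-dec ¬? (s u Bool.≟ s v) ×-dec
    (all? λ x → all? λ y → adjacent x y Bool.≟ true →-dec ¬? (x ≟ c) →-dec ¬? (y ≟ c) →-dec s x Bool.≟ s y))

Spread≤ : Subset 10 → ℕ → Set
Spread≤ S d = ∀ u v → u ∈ S → v ∈ S → dist u v ≤ d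

spread≤? : ∀ S d → Dec (Spread≤ S d)
spread≤? S d = all? λ u → all? λ v → u ∈? S →-dec v ∈? S →-dec dist u v ≤? d

size-bound : ∀ d b → False (anySubset? λ S → spread≤? S d ×-dec b <? ∣ S ∣) →
             ∀ S → Spread≤ S d → ∣ S ∣ ≤ b
size-bound d b none S spread = ℕ.≮⇒≥ λ b<∣S∣ → toWitnessFalse none (S , spread , b<∣S∣)

spread-of-subgraph : ∀ (H : Subgraph G) {d} → DiamBound (V H) (E H) d → Spread≤ (V H) d
spread-of-subgraph H diamBound u v u∈H v∈H =
  let j , j≤d , walk = diamBound u v u∈H v∈H
  in  ℕ.≤-trans (dist≤walkLength adjacent dist-isDistance (walk-lift H walk)) j≤d

G-localDensity≤3 : ∀ (H : Subgraph G) d → 2 ≤ ∣ V H ∣ → HasDiam (V H) (E H) d →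
                   ceilDiv (∣ V H ∣ ∸ 1) d ≤ 3
G-localDensity≤3 H zero    _ _               = z≤n
G-localDensity≤3 H (suc d) _ (diamBound , _) =
  ceilDiv-≤ (∣ V H ∣ ∸ 1) d 3 (ℕ.∸-monoˡ-≤ 1 (size≤ d diamBound))
  where
  size≤ : ∀ d → DiamBound (V H) (E H) (suc d) → ∣ V H ∣ ≤ suc (3 * suc d)
  size≤ zero          db = size-bound 1 4 _ (V H) (spread-of-subgraph H db)
  size≤ (suc zero)    db = ℕ.m≤n⇒m≤1+n (size-bound 2 6 _ (V H) (spread-of-subgraph H db))
  size≤ (suc (suc e)) _  = ℕ.≤-trans (∣p∣≤n (V H)) (s≤s (ℕ.*-monoʳ-≤ 3 (ℕ.m≤m+n 3 e)))

G-localDensity : IsLocalDensity G 3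
G-localDensity = G-localDensity≤3 , wholeGraph G , 3 , s≤s (s≤s z≤n) , G-diameter , refl

layout : Fin 10 → ℤ
layout = +_ ∘ lookup (1 ∷ 2 ∷ 3 ∷ 5 ∷ 0 ∷ 4 ∷ 6 ∷ 7 ∷ 8 ∷ 9 ∷ [])

layout-injective : Injective _≡_ _≡_ layout
layout-injective {u} {v} = from-yes (all? λ u → all? λ v → layout u ℤ.≟ layout v →-dec u ≟ v) u v

layout-bandwidth : BandwidthAtMost G layout 4
layout-bandwidth = from-yes (all? λ u → all? λ v →
  adjacent u v Bool.≟ true →-dec ℤ.∣ layout u ℤ.- layout v ∣ ≤? 4)

open LayoutSearch G 3 using (SpanningOrder; extendable; noLayout)

spanningOrder : List (Fin 10 × Fin 10)
spanningOrder = (# 1 , # 0) ∷ (# 2 , # 0) ∷ (# 3 , # 0) ∷ (# 4 , # 1) ∷ (# 5 , # 1)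
              ∷ (# 6 , # 2) ∷ (# 7 , # 2) ∷ (# 8 , # 3) ∷ (# 9 , # 3) ∷ []

spanningOrder-spans : SpanningOrder spanningOrder
spanningOrder-spans = from-yes (All.all? (λ (v , p) → adjacent p v Bool.≟ true) spanningOrder)

bandwidth-3-search-fails : extendable spanningOrder [ # 0 , 0ℤ ] ≡ false
bandwidth-3-search-fails = refl

G-bandwidth : IsBandwidth G 4
G-bandwidth = isBandwidth-suc {G} (layout , layout-injective , layout-bandwidth)
  (noLayout (# 0) spanningOrder spanningOrder-spans bandwidth-3-search-fails)

theorem1 : Σ Graph λ G → (IsBlockGraph G × GraphDiam G 3 ×
    ∃[ b ] ∃[ β ] (IsBandwidth G b × IsLocalDensity G β × β < b))
theorem1 = G , G-isBlockGraph , G-diameter , 4 , 3 , G-bandwidth , G-localDensity , ℕ.≤-refl
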